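{- Let $G$ be an edge-colored graph, $\vec{G}$ a pruned $r$-th energy graph of $G$, $H\subseteq G$ a subgraph and $\vec{T}\subseteq\vec{G}$ a subgraph. Then for every $k\in[r]$, the quantities $N_k(\vec{T},H,\sigma)$, $S_k(\vec{T},H,\sigma)$ and $D_k(\vec{T},H,\sigma)$ take the same value for all $H$-compatible orderings $\sigma$ of $E(\vec{T})$. Consequently $N=\sum_k N_k$, $S=\sum_k S_k$ and $D=\sum_k D_k$ are also the same for all $H$-compatible orderings.
   Context: Let $G=(V,E)$ be a graph with edge-coloring $\chi:E\to C$, and $r\ge2$. The $r$-th color energy graph of $G$ has vertex set $V^r$, with $(v_1,\dots,v_r)$ adjacent to $(u_1,\dots,u_r)$ iff each $v_ju_j\in E$ and $\chi(v_1u_1)=\dots=\chi(v_ru_r)$. A pruned $r$-th energy graph is a subgraph $\vec{G}$ of the $r$-th color energy graph such that: (1) there is a partition $V=V_1\cup\dots\cup V_r$ with $\lfloor |V|/r\rfloor\le |V_i|\le\lceil |V|/r\rceil$ and $V(\vec G)=V_1\times\dots\times V_r$; (2) each $V_i$ has a partition $V_i=V_i'\cup V_i''$ such that for every edge of $\vec G$ the two $i$-th coordinates lie one in $V_i'$ and one in $V_i''$; (3) any two vertices of $\vec G$ at distance at most 2 in $\vec G$ differ in every coordinate. Let $\pi_k$ be the $k$-th coordinate map; for an edge $\vec x\vec y$ of $\vec G$, $\pi_k(\vec x\vec y)$ is the edge $\pi_k(\vec x)\pi_k(\vec y)$ of $G$. For a vertex $\vec x$, $\pi(\vec x)=\{\pi_1(\vec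 x),\dots,\pi_r(\vec x)\}$; for an edge $\vec e$, $\pi(\vec e)$ is the graph with edges $\pi_1(\vec e),\dots,\pi_r(\vec e)$; for a subgraph $\vec T$, $\pi_k(\vec T)$ and $\pi(\vec T)=\bigcup_k\pi_k(\vec T)$ are the corresponding image subgraphs of $G$. For $F\subseteq G$ let $F_k=F\cap G[V_k]$. Given $H\subseteq G$ and $\vec T\subseteq\vec G$ with $m$ edges, an ordering $\sigma=(\vec e_1,\dots,\vec e_m)$ of $E(\vec T)$ is $H$-compatible if for each $i$ some endpoint $\vec u_i$ of $\vec e_i$ satisfies $\pi(\vec u_i)\subseteq V(H\cup\bigcup_{j<i}\pi(\vec e_j))$; write $\vec e_i=\vec u_i\vec v_i$ with such a $\vec u_i$. Set $H^{(0)}=H$ and $H^{(i)}=H^{(i-1)}\cup\pi(\vec e_i)$. For $i\in[m]$, $k\in[r]$: $n_{i,k}=1$ if $\pi_k(\vec v_i)\notin V(H_k^{(i-1)})$ and $0$ otherwise; $s_{i,k}=1$ if $\pi_k(\vec v_i)\in V(H_k^{(i-1)})$ but $\pi_k(\vec e_i)\notin E(H_k^{(i-1)})$, else $0$; $d_{i,k}=1$ if $\pi_k(\vec e_i)\in E(H_k^{(i-1)})$, else $0$. Define $N_k=\sum_i n_{i,k}$, $S_k=\sum_i s_{i,k}$, $D_k=\sum_i d_{i,k}$ (as functions of $(\vec T,H,\sigma)$). -}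

module Defs where

open import Data.Nat using (ℕ; zero; suc; _+_; _∸_; _≤_; _<_; z≤n; s≤s; >-nonZero)
open import Data.Nat.Properties using (≤-trans)
open import Data.Nat.DivMod using (_/_)
open import Data.Bool using (Bool; true; false; _∧_; _∨_; not; if_then_else_)
open import Data.Fin using (Fin)
open import Data.Fin.Properties using (_≟_)
open import Data.Vec using (Vec; lookup)

open import Data.List using (List; []; _∷_; map; allFin)
open import Data.Nat.ListAction using (sum)
open import Data.Bool.ListAction using (any)
open import Data.List.Relation.Binary.Permutation.Propositional using (_↭_)
open import Data.List.Relation.Binary.Pointwise using (Pointwise)
open import Data.List.Relation.Unary.All using (All)
open import Data.List.Relation.Unary.AllPairs using (AllPairs)
open import Data.Product using (Σ; _×_; _,_; ∃)
open import Data.Sum using (_⊎_)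
open import Data.Unit using (⊤)
open import Relation.Nullary using (¬_)
open import Relation.Nullary.Decidable using (⌊_⌋)
open import Relation.Binary.PropositionalEquality using (_≡_; _≢_)

record Graph (n : ℕ) : Set₁ where
  field
    E       : Fin n → Fin n → Set
    E-sym   : ∀ {u v} → E u v → E v u
    E-irrefl : ∀ {u} → ¬ E u u
open Graph public

-- An edge-colouring χ : E → C, given as a function on ordered pairs that
-- is symmetric on edges (its values on non-edges are irrelevant).
record EdgeColouring {n : ℕ} (G : Graph n) (C : Set) : Set where
  field
    χ     : Fin n → Fin n → C
    χ-sym : ∀ {u v} → E G u v → χ u v ≡ χ v u
open EdgeColouring public

record Subgraph {n : ℕ} (G : Graph n) : Set where
  field
    hV      : Fin n → Bool
    hE      : Fin n → Fin n → Bool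
    hE-sym  : ∀ u v → hE u v ≡ hE v u
    hE-inG  : ∀ {u v} → hE u v ≡ true → E G u v
    hE-endpoints : ∀ {u v} → hE u v ≡ true → hV u ≡ true
open Subgraph public

Tuple : ℕ → ℕ → Set
Tuple n r = Vec (Fin n) r

OEdge : ℕ → ℕ → Set
OEdge n r = Tuple n r × Tuple n r

_==_ : ∀ {n} → Fin n → Fin n → Bool
a == b = ⌊ a ≟ b ⌋

floorDiv : (n r : ℕ) → 2 ≤ r → ℕ
floorDiv n r p = _/_ n r {{>-nonZero (≤-trans (s≤s z≤n) p)}}

ceilDiv : (n r : ℕ) → 2 ≤ r → ℕ
ceilDiv n r p = _/_ (n + (r ∸ 1)) r {{>-nonZero (≤-trans (s≤s z≤n) p)}}

partSize : ∀ {n r} → (Fin n → Fin r) → Fin r → ℕ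
partSize {n} part i = sum (map (λ v → if part v == i then 1 else 0) (allFin n))

record PrunedEnergyGraph {n : ℕ} (r : ℕ) (r≥2 : 2 ≤ r) {C : Set}
         (G : Graph n) (c : EdgeColouring G C) : Set₁ where
  field
    part      : Fin n → Fin r
    part-size : ∀ i → floorDiv n r r≥2 ≤ partSize part i
                    × partSize part i ≤ ceilDiv n r r≥2
    -- (2) each V_i = V_i' ∪ V_i''  (side v = true  ↔  v ∈ V_i' for i = part v)
    side      : Fin n → Bool
    EG        : Tuple n r → Tuple n r → Set
    EG-sym    : ∀ {x y} → EG x y → EG y x
    -- V(G⃗) = V_1 × … × V_r : every edge has endpoints in this product
    EG-vert   : ∀ {x y} → EG x y → ∀ i → part (lookup x i) ≡ i
    -- G⃗ is a subgraph of the r-th colour energy graph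
    EG-edge   : ∀ {x y} → EG x y → ∀ i → E G (lookup x i) (lookup y i)
    EG-colour : ∀ {x y} → EG x y → ∀ i j →
                  χ c (lookup x i) (lookup y i) ≡ χ c (lookup x j) (lookup y j)
    EG-side   : ∀ {x y} → EG x y → ∀ i → side (lookup x i) ≢ side (lookup y i)
    EG-dist1  : ∀ {x y} → EG x y → ∀ i → lookup x i ≢ lookup y i
    EG-dist2  : ∀ {x y z} → EG x z → EG z y → x ≢ y → ∀ i → lookup x i ≢ lookup y i
open PrunedEnergyGraph public

SameEdge : ∀ {n r} → OEdge n r → OEdge n r → Set
SameEdge (u , v) (x , y) = (u ≡ x × v ≡ y) ⊎ (u ≡ y × v ≡ x)

IsSubgraphEdges : ∀ {n r r≥2 C} {G : Graph n} {c : EdgeColouring G C} →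
                  PrunedEnergyGraph r r≥2 G c → List (OEdge n r) → Set
IsSubgraphEdges P TE =
  All (λ e → EG P (Data.Product.proj₁ e) (Data.Product.proj₂ e)) TE
  × AllPairs (λ e f → ¬ SameEdge e f) TE

-- σ = ((u_1,v_1),…,(u_m,v_m)) is an ordering of E(T⃗) (each edge listed
-- exactly once, together with a chosen orientation e_i = u_i v_i)
IsOrdering : ∀ {n r} → List (OEdge n r) → List (OEdge n r) → Set
IsOrdering {n} {r} TE σ = Σ (List (OEdge n r)) λ σ' → (σ ↭ σ') × Pointwise SameEdge σ' TE

-- H^{(i)} = H ∪ π(e_1) ∪ … ∪ π(e_i), given the list `pre` of e_1..e_i

allIdx : (r : ℕ) → List (Fin r)
allIdx r = allFin r

vertH : ∀ {n r} {G : Graph n} → Subgraph G → List (OEdge n r) → Fin n → Bool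
vertH {r = r} H pre a =
  hV H a ∨ any (λ e → any (λ k → (lookup (Data.Product.proj₁ e) k == a)
                             ∨ (lookup (Data.Product.proj₂ e) k == a)) (allIdx r)) pre

edgeH : ∀ {n r} {G : Graph n} → Subgraph G → List (OEdge n r) → Fin n → Fin n → Bool
edgeH {r = r} H pre a b =
  hE H a b ∨ any (λ e → any (λ k →
      let x = lookup (Data.Product.proj₁ e) k ; y = lookup (Data.Product.proj₂ e) k in
      ((x == a) ∧ (y == b)) ∨ ((x == b) ∧ (y == a))) (allIdx r)) pre

vertHk : ∀ {n r} {G : Graph n} → (Fin n → Fin r) → Subgraph G → List (OEdge n r)
         → Fin r → Fin n → Bool
vertHk part H pre k a = (part a == k) ∧ vertH H pre a

edgeHk : ∀ {n r} {G : Graph n} → (Fin n → Fin r) → Subgraph G → List (OEdge n r)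
         → Fin r → Fin n → Fin n → Bool
edgeHk part H pre k a b = (part a == k) ∧ (part b == k) ∧ edgeH H pre a b

CompatibleFrom : ∀ {n r} {G : Graph n} → Subgraph G → List (OEdge n r) → List (OEdge n r) → Set
CompatibleFrom H pre [] = ⊤
CompatibleFrom H pre ((u , v) ∷ σ) =
  (∀ k → vertH H pre (lookup u k) ≡ true) × CompatibleFrom H ((u , v) ∷ pre) σ

Compatible : ∀ {n r} {G : Graph n} → Subgraph G → List (OEdge n r) → Set
Compatible H σ = CompatibleFrom H [] σ

ind : Bool → ℕ
ind true  = 1
ind false = 0

nInd sInd dInd : ∀ {n r} {G : Graph n} → (Fin n → Fin r) → Subgraph G →
                 List (OEdge n r) → OEdge n r → Fin r → ℕ
nInd part H pre (u , v) k = ind (not (vertHk part H pre k (lookup v k)))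
sInd part H pre (u , v) k =
  ind (vertHk part H pre k (lookup v k) ∧ not (edgeHk part H pre k (lookup u k) (lookup v k)))
dInd part H pre (u , v) k = ind (edgeHk part H pre k (lookup u k) (lookup v k))

-- Σ_i f(H^{(i-1)}, e_i)
sumAlong : ∀ {n r} → (List (OEdge n r) → OEdge n r → ℕ) →
           List (OEdge n r) → List (OEdge n r) → ℕ
sumAlong f pre [] = 0
sumAlong f pre (e ∷ σ) = f pre e + sumAlong f (e ∷ pre) σ

Nk Sk Dk : ∀ {n r} {G : Graph n} → (Fin n → Fin r) → Subgraph G →
           List (OEdge n r) → Fin r → ℕ
Nk part H σ k = sumAlong (λ pre e → nInd part H pre e k) [] σ
Sk part H σ k = sumAlong (λ pre e → sInd part H pre e k) [] σ
Dk part H σ k = sumAlong (λ pre e → dInd part H pre e k) [] σ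

sumK : (r : ℕ) → (Fin r → ℕ) → ℕ
sumK r f = sum (map f (allFin r))

Ntot Stot Dtot : ∀ {n r} {G : Graph n} → (Fin n → Fin r) → Subgraph G →
                 List (OEdge n r) → ℕ
Ntot {r = r} part H σ = sumK r (Nk part H σ)
Stot {r = r} part H σ = sumK r (Sk part H σ)
Dtot {r = r} part H σ = sumK r (Dk part H σ)

module Submission where

open import Defs
open import Algebra.Bundles using (CommutativeMonoid)
open import Data.Bool using (Bool; true; false; _∧_; _∨_; not; T)
open import Data.Bool.ListAction using (any)
open import Data.Bool.Properties
  using (∨-comm; ∨-assoc; ∧-assoc; ∨-identityʳ; T-∨; T-∧; T-≡)
  renaming (∧-commutativeMonoid to ∧-cm; ∨-commutativeMonoid to ∨-cm)
open import Data.Empty using (⊥-elim)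
open import Data.Fin using (Fin)
import Data.Fin.Properties as Fin
open import Data.List using (List; []; _∷_; length; map; allFin)
open import Data.List.Membership.Propositional using (lose)
open import Data.List.Membership.Propositional.Properties using (∈-allFin)
open import Data.List.Properties using (map-cong)
open import Data.List.Relation.Binary.Permutation.Propositional as ↭ using (_↭_)
open import Data.List.Relation.Binary.Permutation.Propositional.Properties
  using (shifts; ++⁺ˡ; map⁺; ↭-length; All-resp-↭)
open import Data.List.Relation.Binary.Pointwise as Pointwise using (Pointwise; []; _∷_; Pointwise-length)
open import Data.List.Relation.Unary.All as All using (All; []; _∷_)
open import Data.List.Relation.Unary.Any as Any using (satisfied)
open import Data.List.Relation.Unary.Any.Properties using (any⁺; any⁻)
open import Data.Nat using (ℕ; _+_; _≤_)
open import Data.Nat.ListAction using (sum)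
open import Data.Nat.Properties using (+-assoc; +-comm; +-cancelˡ-≡; +-cancelʳ-≡; +-commutativeSemigroup)
open import Data.Product using (_×_; _,_; proj₁; proj₂)
open import Data.Sum using (_⊎_; inj₁; inj₂)
open import Data.Vec using (lookup)
open import Function using (_∘_; _⇔_; mk⇔; Equivalence)
open import Relation.Binary using (DecSetoid; Rel; Decidable; DecidableEquality; _Preserves_⟶_)
open import Relation.Binary.PropositionalEquality
  using (_≡_; refl; sym; trans; cong; cong₂; subst; _≗_; module ≡-Reasoning)
open import Relation.Nullary using (yes; no; does)
open import Relation.Nullary.Decidable
  using (⌊_⌋; does-⇔; T?; _×-dec_; _⊎-dec_; isYes≗does; toWitness; fromWitness)

open import Algebra.Properties.CommutativeSemigroup
  (CommutativeMonoid.commutativeSemigroup ∧-cm) using () renaming (x∙yz≈y∙xz to ∧-leftComm)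
open import Algebra.Properties.CommutativeSemigroup +-commutativeSemigroup
  using () renaming (interchange to +-interchange)
open import Algebra.Properties.CommutativeSemigroup
  (CommutativeMonoid.commutativeSemigroup ∨-cm) using () renaming (xy∙z≈xz∙y to ∨-rightComm)

-- For a fixed coordinate k, processing e_i = u_i v_i enlarges H_k by exactly the
-- vertices π_k(u_i), π_k(v_i) and the edge π_k(e_i): every coordinate of a vertex of
-- G⃗ lies in its own part, so the other coordinates never meet V_k.  Compatibility
-- puts π_k(u_i) in H_k already, hence N_k is the number of distinct vertices among
-- the π_k(v_i) that are new to H_k, and D_k is m minus the number of distinct
-- undirected edges among the π_k(e_i) that are new to H_k.  Such counts of new
-- distinct elements do not change when a list is permuted or its edges reoriented,
-- so N_k and D_k do not depend on σ; neither does S_k = m − N_k − D_k, because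
-- n_{i,k} + s_{i,k} + d_{i,k} = 1.  Of the pruning conditions only the placement of
-- coordinates in parts is used.

T-⇔⇒≡ : ∀ {a b} → T a ⇔ T b → a ≡ b
T-⇔⇒≡ {a} {b} a⇔b = does-⇔ a⇔b (T? a) (T? b)

any-allFin-focus : ∀ {r} (f : Fin r → Bool) {k : Fin r} → (∀ {j} → T (f j) → j ≡ k) →
                   any f (allFin r) ≡ f k
any-allFin-focus {r} f {k} only-k = T-⇔⇒≡ (mk⇔ hit⇒k (any⁺ f ∘ lose (∈-allFin k)))
  where
  hit⇒k : T (any f (allFin r)) → T (f k)
  hit⇒k hit with j , fj ← satisfied (any⁻ f (allFin r) hit) = subst (T ∘ f) (only-k fj) fj

any-mono : ∀ {a} {A : Set a} {f g : A → Bool} → (∀ x → T (f x) → T (g x)) →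
           ∀ xs → T (any f xs) → T (any g xs)
any-mono f⇒g xs = any⁺ _ ∘ Any.map (f⇒g _) ∘ any⁻ _ xs

-- The shape of vertHk and edgeHk after prepending an edge: under the restriction p to
-- V_k, the hits F of the new edge in all coordinates reduce to its hit X in coordinate k.
∧-∨-extend : ∀ p h F R X → (T p → F ≡ X) → (T X → T p) →
             p ∧ (h ∨ (F ∨ R)) ≡ (p ∧ (h ∨ R)) ∨ X
∧-∨-extend true  h     F R X F≡X _ rewrite F≡X _ = rotate h
  where
  rotate : ∀ h → h ∨ (X ∨ R) ≡ (h ∨ R) ∨ X
  rotate true  = refl
  rotate false = ∨-comm X R
∧-∨-extend false h F R false _ _   = refl
∧-∨-extend false h F R true  _ X⇒p = ⊥-elim (X⇒p _)

ab∨ba⇒b : ∀ p q s t → T ((p ∧ q) ∨ (s ∧ t)) → T (s ∨ q)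
ab∨ba⇒b _     _     true  _ _ = _
ab∨ba⇒b true  true  false _ _ = _
ab∨ba⇒b true  false false _ ()
ab∨ba⇒b false _     false _ ()

ind-+-not : ∀ b → ind b + ind (not b) ≡ 1
ind-+-not true  = refl
ind-+-not false = refl

ind-trichotomy : ∀ B E → (T E → T B) → ind (not B) + ind (B ∧ not E) + ind E ≡ 1
ind-trichotomy true  true  _   = refl
ind-trichotomy true  false _   = refl
ind-trichotomy false false _   = refl
ind-trichotomy false true  E⇒B = ⊥-elim (E⇒B _)

module FreshCount {a ℓ} (S : DecSetoid a ℓ) where
  open DecSetoid S using (_≈_; _≟_)
    renaming (Carrier to A; refl to ≈-refl; sym to ≈-sym; trans to ≈-trans)

  insert : (A → Bool) → A → A → Bool
  insert s x z = s z ∨ ⌊ x ≟ z ⌋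

  fresh : (A → Bool) → List A → ℕ
  fresh s []       = 0
  fresh s (x ∷ xs) = ind (not (s x)) + fresh (insert s x) xs

  ⌊≟⌋-cong : ∀ {x x' y y'} → x ≈ x' → y ≈ y' → ⌊ x ≟ y ⌋ ≡ ⌊ x' ≟ y' ⌋
  ⌊≟⌋-cong {x} {x'} {y} {y'} x≈x' y≈y' = begin
    ⌊ x ≟ y ⌋      ≡⟨ isYes≗does (x ≟ y) ⟩
    does (x ≟ y)   ≡⟨ does-⇔ x≈y⇔x'≈y' (x ≟ y) (x' ≟ y') ⟩
    does (x' ≟ y') ≡⟨ isYes≗does (x' ≟ y') ⟨
    ⌊ x' ≟ y' ⌋    ∎
    where
    open ≡-Reasoning
    x≈y⇔x'≈y' : x ≈ y ⇔ x' ≈ y'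
    x≈y⇔x'≈y' = mk⇔ (λ x≈y → ≈-trans (≈-sym x≈x') (≈-trans x≈y y≈y'))
                    (λ x'≈y' → ≈-trans x≈x' (≈-trans x'≈y' (≈-sym y≈y')))

  insert-preserves : ∀ {s} → s Preserves _≈_ ⟶ _≡_ → ∀ x → insert s x Preserves _≈_ ⟶ _≡_
  insert-preserves s-pres x z≈z' = cong₂ _∨_ (s-pres z≈z') (⌊≟⌋-cong ≈-refl z≈z')

  insert-absorb : ∀ {s x} → s Preserves _≈_ ⟶ _≡_ → s x ≡ true → insert s x ≗ s
  insert-absorb {s} {x} s-pres sx z with x ≟ z
  ... | yes x≈z rewrite trans (sym (s-pres x≈z)) sx = refl
  ... | no  _   = ∨-identityʳ (s z)

  fresh-cong : ∀ {s t} → s ≗ t → ∀ xs → fresh s xs ≡ fresh t xs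
  fresh-cong s≗t []       = refl
  fresh-cong s≗t (x ∷ xs) =
    cong₂ _+_ (cong (ind ∘ not) (s≗t x)) (fresh-cong (λ z → cong (_∨ _) (s≗t z)) xs)

  fresh-swap : ∀ {s} → s Preserves _≈_ ⟶ _≡_ → ∀ x y xs →
               fresh s (x ∷ y ∷ xs) ≡ fresh s (y ∷ x ∷ xs)
  fresh-swap {s} s-pres x y xs = begin
    ind (not (s x)) + (ind (not (insert s x y)) + fresh (insert (insert s x) y) xs)
      ≡⟨ +-assoc (ind (not (s x))) _ _ ⟨
    ind (not (s x)) + ind (not (insert s x y)) + fresh (insert (insert s x) y) xs
      ≡⟨ cong₂ _+_ heads tails ⟩
    ind (not (s y)) + ind (not (insert s y x)) + fresh (insert (insert s y) x) xs
      ≡⟨ +-assoc (ind (not (s y))) _ _ ⟩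
    ind (not (s y)) + (ind (not (insert s y x)) + fresh (insert (insert s y) x) xs) ∎
    where
    open ≡-Reasoning
    heads : ind (not (s x)) + ind (not (insert s x y)) ≡ ind (not (s y)) + ind (not (insert s y x))
    heads with x ≟ y | y ≟ x
    ... | yes x≈y | yes _   rewrite s-pres x≈y = refl
    ... | yes x≈y | no y≉x  = ⊥-elim (y≉x (≈-sym x≈y))
    ... | no x≉y  | yes y≈x = ⊥-elim (x≉y (≈-sym y≈x))
    ... | no _    | no _    rewrite ∨-identityʳ (s x) | ∨-identityʳ (s y) = +-comm (ind (not (s x))) _
    tails : fresh (insert (insert s x) y) xs ≡ fresh (insert (insert s y) x) xs
    tails = fresh-cong (λ z → ∨-rightComm (s z) ⌊ x ≟ z ⌋ ⌊ y ≟ z ⌋) xs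

  fresh-↭ : ∀ {s xs ys} → s Preserves _≈_ ⟶ _≡_ → xs ↭ ys → fresh s xs ≡ fresh s ys
  fresh-↭ s-pres ↭.refl         = refl
  fresh-↭ {s} s-pres (↭.prep x p) =
    cong (ind (not (s x)) +_) (fresh-↭ (insert-preserves s-pres x) p)
  fresh-↭ {s} s-pres (↭.swap {xs} x y p) = trans (fresh-swap s-pres x y xs)
    (cong (ind (not (s y)) +_) (cong (ind (not (insert s y x)) +_)
      (fresh-↭ (insert-preserves (insert-preserves s-pres y) x) p)))
  fresh-↭ s-pres (↭.trans p q)  = trans (fresh-↭ s-pres p) (fresh-↭ s-pres q)

  fresh-pointwise : ∀ {s xs ys} → s Preserves _≈_ ⟶ _≡_ → Pointwise _≈_ xs ys →
                    fresh s xs ≡ fresh s ys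
  fresh-pointwise s-pres []                   = refl
  fresh-pointwise {s} {ys = _ ∷ ys} s-pres (x≈y ∷ xs≈ys) = cong₂ _+_ (cong (ind ∘ not) (s-pres x≈y))
    (trans (fresh-pointwise (insert-preserves s-pres _) xs≈ys)
           (fresh-cong (λ z → cong (s z ∨_) (⌊≟⌋-cong x≈y (≈-refl {z}))) ys))

module UnorderedPair {a} {A : Set a} (_≟_ : DecidableEquality A) where

  _≈ᵤ_ : Rel (A × A) a
  (x , y) ≈ᵤ (x' , y') = (x ≡ x' × y ≡ y') ⊎ (x ≡ y' × y ≡ x')

  _≟ᵤ_ : Decidable _≈ᵤ_
  (x , y) ≟ᵤ (x' , y') = (x ≟ x' ×-dec y ≟ y') ⊎-dec (x ≟ y' ×-dec y ≟ x')

  ⌊≟ᵤ⌋ : ∀ x y x' y' →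
         ⌊ (x , y) ≟ᵤ (x' , y') ⌋
           ≡ (⌊ x ≟ x' ⌋ ∧ ⌊ y ≟ y' ⌋) ∨ (⌊ x ≟ y' ⌋ ∧ ⌊ y ≟ x' ⌋)
  ⌊≟ᵤ⌋ x y x' y'
    rewrite isYes≗does ((x , y) ≟ᵤ (x' , y'))
          | isYes≗does (x ≟ x') | isYes≗does (y ≟ y')
          | isYes≗does (x ≟ y') | isYes≗does (y ≟ x') = refl

  decSetoid : DecSetoid a a
  decSetoid = record
    { Carrier          = A × A
    ; _≈_              = _≈ᵤ_
    ; isDecEquivalence = record
      { isEquivalence = record { refl = ≈ᵤ-refl ; sym = ≈ᵤ-sym ; trans = ≈ᵤ-trans }
      ; _≟_           = _≟ᵤ_
      }
    }
    where
    ≈ᵤ-refl : ∀ {p} → p ≈ᵤ p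
    ≈ᵤ-refl = inj₁ (refl , refl)
    ≈ᵤ-sym : ∀ {p q} → p ≈ᵤ q → q ≈ᵤ p
    ≈ᵤ-sym (inj₁ (refl , refl)) = inj₁ (refl , refl)
    ≈ᵤ-sym (inj₂ (refl , refl)) = inj₂ (refl , refl)
    ≈ᵤ-trans : ∀ {p q s} → p ≈ᵤ q → q ≈ᵤ s → p ≈ᵤ s
    ≈ᵤ-trans (inj₁ (refl , refl)) q≈s                  = q≈s
    ≈ᵤ-trans (inj₂ (refl , refl)) (inj₁ (refl , refl)) = inj₂ (refl , refl)
    ≈ᵤ-trans (inj₂ (refl , refl)) (inj₂ (refl , refl)) = inj₁ (refl , refl)

ordering-length : ∀ {n r} {TE σ : List (OEdge n r)} → IsOrdering TE σ → length σ ≡ length TE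
ordering-length (_ , σ↭σ′ , σ′≈TE) = trans (↭-length σ↭σ′) (Pointwise-length σ′≈TE)

sumAlong-+ : ∀ {n r} (f g : List (OEdge n r) → OEdge n r → ℕ) pre σ →
             sumAlong (λ p e → f p e + g p e) pre σ ≡ sumAlong f pre σ + sumAlong g pre σ
sumAlong-+ f g pre []      = refl
sumAlong-+ f g pre (e ∷ σ) =
  trans (cong (f pre e + g pre e +_) (sumAlong-+ f g (e ∷ pre) σ)) (+-interchange (f pre e) (g pre e) _ _)

sumAlong-≡1 : ∀ {n r} {f : List (OEdge n r) → OEdge n r → ℕ} → (∀ pre e → f pre e ≡ 1) →
              ∀ pre σ → sumAlong f pre σ ≡ length σ
sumAlong-≡1 f≡1 pre []      = refl
sumAlong-≡1 f≡1 pre (e ∷ σ) = cong₂ _+_ (f≡1 pre e) (sumAlong-≡1 f≡1 (e ∷ pre) σ)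

==⇒≡ : ∀ {n} {x y : Fin n} → T (x == y) → x ≡ y
==⇒≡ {x = x} {y} = toWitness {a? = x Fin.≟ y}

≡⇒== : ∀ {n} {x y : Fin n} → x ≡ y → T (x == y)
≡⇒== {x = x} {y} = fromWitness {a? = x Fin.≟ y}

InParts : ∀ {n r} → (Fin n → Fin r) → Tuple n r → Set
InParts part x = ∀ i → part (lookup x i) ≡ i

InPartsEdge : ∀ {n r} → (Fin n → Fin r) → OEdge n r → Set
InPartsEdge part (u , v) = InParts part u × InParts part v

edgeH⇒vertH : ∀ {n r} {G : Graph n} (H : Subgraph G) (pre : List (OEdge n r)) {a b} →
              T (edgeH H pre a b) → T (vertH H pre b)
edgeH⇒vertH {r = r} H pre {a} {b} ab∈H′ with Equivalence.to (T-∨ {hE H a b}) ab∈H′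
... | inj₁ ab∈H =
  Equivalence.from T-∨ (inj₁ (Equivalence.from T-≡
    (hE-endpoints H (trans (hE-sym H b a) (Equivalence.to T-≡ ab∈H)))))
... | inj₂ ab∈pre =
  Equivalence.from T-∨ (inj₂ (any-mono (λ e → any-mono (λ j → endpoint (lookup (proj₁ e) j) (lookup (proj₂ e) j))
                                                   (allFin r))
                                        pre ab∈pre))
  where
  endpoint : ∀ x y → T (((x == a) ∧ (y == b)) ∨ ((x == b) ∧ (y == a))) → T ((x == b) ∨ (y == b))
  endpoint x y = ab∨ba⇒b (x == a) (y == b) (x == b) (y == a)

module Coordinate {n r : ℕ} {G : Graph n} (part : Fin n → Fin r) (H : Subgraph G) (k : Fin r) where

  module V = FreshCount (Fin.≡-decSetoid n)
  module E = FreshCount (UnorderedPair.decSetoid (Fin._≟_ {n}))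
  open UnorderedPair (Fin._≟_ {n}) using (_≈ᵤ_; _≟ᵤ_; ⌊≟ᵤ⌋)

  πₖ : OEdge n r → Fin n × Fin n
  πₖ (u , v) = lookup u k , lookup v k

  -- pre lists the processed edges newest first: Hv pre and He pre are the vertex and
  -- edge sets of H_k^{(i)} for pre = e_i ∷ … ∷ e_1.
  Hv : List (OEdge n r) → Fin n → Bool
  Hv pre = vertHk part H pre k

  He : List (OEdge n r) → Fin n × Fin n → Bool
  He pre (a , b) = edgeHk part H pre k a b

  in-part : ∀ x {j a} → InParts part x → lookup x j ≡ a → part a ≡ j
  in-part x x-in refl = x-in _

  Hv-∷ : ∀ pre u v → InPartsEdge part (u , v) →
         Hv ((u , v) ∷ pre) ≗ V.insert (V.insert (Hv pre) (lookup u k)) (lookup v k)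
  Hv-∷ pre u v (u-in , v-in) a =
    trans (∧-∨-extend (part a == k) (hV H a) (any hit (allFin r)) _ (hit k) focus hit⇒part)
          (sym (∨-assoc (Hv pre a) _ _))
    where
    hit : Fin r → Bool
    hit j = (lookup u j == a) ∨ (lookup v j == a)
    hit⇒in-part : ∀ {j} → T (hit j) → part a ≡ j
    hit⇒in-part {j} t with Equivalence.to (T-∨ {lookup u j == a}) t
    ... | inj₁ u≡a = in-part u u-in (==⇒≡ u≡a)
    ... | inj₂ v≡a = in-part v v-in (==⇒≡ v≡a)
    focus : T (part a == k) → any hit (allFin r) ≡ hit k
    focus a∈k = any-allFin-focus hit (λ t → trans (sym (hit⇒in-part t)) (==⇒≡ a∈k))
    hit⇒part : T (hit k) → T (part a == k)
    hit⇒part t = ≡⇒== (hit⇒in-part t)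

  He-∷ : ∀ pre e → InPartsEdge part e → He (e ∷ pre) ≗ E.insert (He pre) (πₖ e)
  He-∷ pre (u , v) (u-in , v-in) (a , b) =
    trans (sym (∧-assoc (part a == k) (part b == k) _))
      (trans (∧-∨-extend ((part a == k) ∧ (part b == k)) (hE H a b) (any hit (allFin r)) _
                         (hit′ k) focus hit⇒parts)
             (cong (_∨ hit′ k) (∧-assoc (part a == k) (part b == k) _)))
    where
    hit hit′ : Fin r → Bool
    hit j = ((lookup u j == a) ∧ (lookup v j == b)) ∨ ((lookup u j == b) ∧ (lookup v j == a))
    hit′ j = ⌊ (lookup u j , lookup v j) ≟ᵤ (a , b) ⌋
    hit≡hit′ : ∀ j → hit j ≡ hit′ j
    hit≡hit′ j = sym (⌊≟ᵤ⌋ (lookup u j) (lookup v j) a b)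
    hit⇒in-parts : ∀ {j} → T (hit′ j) → part a ≡ j × part b ≡ j
    hit⇒in-parts t with toWitness t
    ... | inj₁ (u≡a , v≡b) = in-part u u-in u≡a , in-part v v-in v≡b
    ... | inj₂ (u≡b , v≡a) = in-part v v-in v≡a , in-part u u-in u≡b
    focus : T ((part a == k) ∧ (part b == k)) → any hit (allFin r) ≡ hit′ k
    focus ab∈k = trans (any-allFin-focus hit only-k) (hit≡hit′ k)
      where
      only-k : ∀ {j} → T (hit j) → j ≡ k
      only-k {j} t = trans (sym (proj₁ (hit⇒in-parts (subst T (hit≡hit′ j) t))))
                           (==⇒≡ (proj₁ (Equivalence.to T-∧ ab∈k)))
    hit⇒parts : T (hit′ k) → T ((part a == k) ∧ (part b == k))
    hit⇒parts t = Equivalence.from T-∧ (≡⇒== (proj₁ (hit⇒in-parts t)) , ≡⇒== (proj₂ (hit⇒in-parts t)))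

  Nₖ Sₖ Dₖ : List (OEdge n r) → List (OEdge n r) → ℕ
  Nₖ = sumAlong (λ pre e → nInd part H pre e k)
  Sₖ = sumAlong (λ pre e → sInd part H pre e k)
  Dₖ = sumAlong (λ pre e → dInd part H pre e k)

  He⇒Hv : ∀ pre {a b} → T (He pre (a , b)) → T (Hv pre b)
  He⇒Hv pre {a} {b} ab∈H with Equivalence.to (T-∧ {part a == k}) ab∈H
  ... | _ , ab∈H′ with Equivalence.to (T-∧ {part b == k}) ab∈H′
  ... | b∈k , ab∈H″ = Equivalence.from T-∧ (b∈k , edgeH⇒vertH H pre ab∈H″)

  Nₖ+Sₖ+Dₖ≡length : ∀ pre σ → Nₖ pre σ + Sₖ pre σ + Dₖ pre σ ≡ length σ
  Nₖ+Sₖ+Dₖ≡length pre σ = begin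
    Nₖ pre σ + Sₖ pre σ + Dₖ pre σ
      ≡⟨ cong (_+ Dₖ pre σ) (sumAlong-+ _ _ pre σ) ⟨
    sumAlong (λ p e → nInd part H p e k + sInd part H p e k) pre σ + Dₖ pre σ
      ≡⟨ sumAlong-+ _ _ pre σ ⟨
    sumAlong (λ p e → nInd part H p e k + sInd part H p e k + dInd part H p e k) pre σ
      ≡⟨ sumAlong-≡1 (λ p (u , v) → ind-trichotomy _ _ (He⇒Hv p)) pre σ ⟩
    length σ ∎
    where open ≡-Reasoning

  endpointsₖ : List (OEdge n r) → List (Fin n)
  endpointsₖ []            = []
  endpointsₖ ((u , v) ∷ σ) = lookup u k ∷ lookup v k ∷ endpointsₖ σ

  Nₖ-fresh : ∀ pre {σ s} → All (InPartsEdge part) σ → CompatibleFrom H pre σ → s ≗ Hv pre →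
             Nₖ pre σ ≡ V.fresh s (endpointsₖ σ)
  Nₖ-fresh pre {[]}          _              _                   _    = refl
  Nₖ-fresh pre {(u , v) ∷ σ} {s} (uv-in ∷ σ-in) (u∈H , σ-compat) s≗Hv = begin
    ind (not (Hv pre v′)) + Nₖ ((u , v) ∷ pre) σ
      ≡⟨ cong₂ _+_ (cong (ind ∘ not) v-step) (Nₖ-fresh ((u , v) ∷ pre) σ-in σ-compat s′≗Hv′) ⟩
    ind (not (V.insert s u′ v′)) + V.fresh s′ (endpointsₖ σ)
      ≡⟨ cong (λ b → ind (not b) + (ind (not (V.insert s u′ v′)) + V.fresh s′ (endpointsₖ σ))) u-known ⟨
    V.fresh s (endpointsₖ ((u , v) ∷ σ)) ∎
    where
    open ≡-Reasoning
    u′ v′ : Fin n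
    u′ = lookup u k
    v′ = lookup v k
    s′ : Fin n → Bool
    s′ = V.insert (V.insert s u′) v′
    u-known : s u′ ≡ true
    u-known = trans (s≗Hv u′) (cong₂ _∧_ (Equivalence.to T-≡ (≡⇒== (proj₁ uv-in k))) (u∈H k))
    v-step : Hv pre v′ ≡ V.insert s u′ v′
    v-step = sym (trans (V.insert-absorb (cong s) u-known v′) (s≗Hv v′))
    s′≗Hv′ : s′ ≗ Hv ((u , v) ∷ pre)
    s′≗Hv′ z = trans (cong (λ b → (b ∨ (u′ == z)) ∨ (v′ == z)) (s≗Hv z)) (sym (Hv-∷ pre u v uv-in z))

  Dₖ+fresh≡length : ∀ pre {σ s} → All (InPartsEdge part) σ → s ≗ He pre →
                    Dₖ pre σ + E.fresh s (map πₖ σ) ≡ length σ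
  Dₖ+fresh≡length pre {[]}    _              _    = refl
  Dₖ+fresh≡length pre {e ∷ σ} {s} (e-in ∷ σ-in) s≗He = begin
    ind (He pre (πₖ e)) + Dₖ (e ∷ pre) σ + (ind (not (s (πₖ e))) + E.fresh s′ (map πₖ σ))
      ≡⟨ +-interchange (ind (He pre (πₖ e))) _ _ _ ⟩
    ind (He pre (πₖ e)) + ind (not (s (πₖ e))) + (Dₖ (e ∷ pre) σ + E.fresh s′ (map πₖ σ))
      ≡⟨ cong₂ _+_ (trans (cong (λ b → ind (He pre (πₖ e)) + ind (not b)) (s≗He (πₖ e)))
                          (ind-+-not (He pre (πₖ e))))
                   (Dₖ+fresh≡length (e ∷ pre) σ-in s′≗He′) ⟩
    1 + length σ ∎
    where
    open ≡-Reasoning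
    s′ : Fin n × Fin n → Bool
    s′ = E.insert s (πₖ e)
    s′≗He′ : s′ ≗ He (e ∷ pre)
    s′≗He′ z = trans (cong (λ b → b ∨ ⌊ πₖ e ≟ᵤ z ⌋) (s≗He z)) (sym (He-∷ pre e e-in z))

  endpointsₖ-↭ : ∀ {σ σ′} → σ ↭ σ′ → endpointsₖ σ ↭ endpointsₖ σ′
  endpointsₖ-↭ ↭.refl         = ↭.refl
  endpointsₖ-↭ (↭.prep e p)   = ↭.prep _ (↭.prep _ (endpointsₖ-↭ p))
  endpointsₖ-↭ (↭.swap (u , v) (u′ , v′) p) =
    ↭.trans (shifts (lookup u k ∷ lookup v k ∷ []) (lookup u′ k ∷ lookup v′ k ∷ []))
            (++⁺ˡ (lookup u′ k ∷ lookup v′ k ∷ lookup u k ∷ lookup v k ∷ []) (endpointsₖ-↭ p))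
  endpointsₖ-↭ (↭.trans p q)  = ↭.trans (endpointsₖ-↭ p) (endpointsₖ-↭ q)

  endpointsₖ-SameEdge : ∀ {σ σ′} → Pointwise SameEdge σ σ′ → endpointsₖ σ ↭ endpointsₖ σ′
  endpointsₖ-SameEdge []                          = ↭.refl
  endpointsₖ-SameEdge (inj₁ (refl , refl) ∷ same) = ↭.prep _ (↭.prep _ (endpointsₖ-SameEdge same))
  endpointsₖ-SameEdge (inj₂ (refl , refl) ∷ same) = ↭.swap _ _ (endpointsₖ-SameEdge same)

  πₖ-SameEdge : ∀ {e f} → SameEdge e f → πₖ e ≈ᵤ πₖ f
  πₖ-SameEdge (inj₁ (refl , refl)) = inj₁ (refl , refl)
  πₖ-SameEdge (inj₂ (refl , refl)) = inj₂ (refl , refl)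

  He[]-preserves : He [] Preserves _≈ᵤ_ ⟶ _≡_
  He[]-preserves (inj₁ (refl , refl)) = refl
  He[]-preserves {a , b} (inj₂ (refl , refl)) =
    trans (cong (λ h → (part a == k) ∧ (part b == k) ∧ (h ∨ false)) (hE-sym H a b))
          (∧-leftComm (part a == k) (part b == k) _)

  Nₖ-canonical : ∀ {TE σ} → IsOrdering TE σ → All (InPartsEdge part) σ → Compatible H σ →
                 Nₖ [] σ ≡ V.fresh (Hv []) (endpointsₖ TE)
  Nₖ-canonical (_ , σ↭σ′ , σ′≈TE) σ-in σ-compat =
    trans (Nₖ-fresh [] σ-in σ-compat (λ _ → refl))
          (V.fresh-↭ (cong (Hv [])) (↭.trans (endpointsₖ-↭ σ↭σ′) (endpointsₖ-SameEdge σ′≈TE)))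

  Dₖ-canonical : ∀ {TE σ} → IsOrdering TE σ → All (InPartsEdge part) σ →
                 Dₖ [] σ + E.fresh (He []) (map πₖ TE) ≡ length TE
  Dₖ-canonical {TE} {σ} ord@(_ , σ↭σ′ , σ′≈TE) σ-in = begin
    Dₖ [] σ + E.fresh (He []) (map πₖ TE)
      ≡⟨ cong (Dₖ [] σ +_) edges-↭ ⟨
    Dₖ [] σ + E.fresh (He []) (map πₖ σ)
      ≡⟨ Dₖ+fresh≡length [] σ-in (λ _ → refl) ⟩
    length σ
      ≡⟨ ordering-length ord ⟩
    length TE ∎
    where
    open ≡-Reasoning
    edges-↭ : E.fresh (He []) (map πₖ σ) ≡ E.fresh (He []) (map πₖ TE)
    edges-↭ = trans (E.fresh-↭ He[]-preserves (map⁺ πₖ σ↭σ′))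
                    (E.fresh-pointwise He[]-preserves
                      (Pointwise.map⁺ πₖ πₖ (Pointwise.map πₖ-SameEdge σ′≈TE)))

  NSDₖ-invariant : ∀ {TE σ₁ σ₂} →
                   IsOrdering TE σ₁ → All (InPartsEdge part) σ₁ → Compatible H σ₁ →
                   IsOrdering TE σ₂ → All (InPartsEdge part) σ₂ → Compatible H σ₂ →
                   (Nₖ [] σ₁ ≡ Nₖ [] σ₂) × (Sₖ [] σ₁ ≡ Sₖ [] σ₂) × (Dₖ [] σ₁ ≡ Dₖ [] σ₂)
  NSDₖ-invariant {TE} {σ₁} {σ₂} ord₁ in₁ compat₁ ord₂ in₂ compat₂ = N≡ , S≡ , D≡
    where
    open ≡-Reasoning
    N≡ : Nₖ [] σ₁ ≡ Nₖ [] σ₂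
    N≡ = trans (Nₖ-canonical ord₁ in₁ compat₁) (sym (Nₖ-canonical ord₂ in₂ compat₂))
    D≡ : Dₖ [] σ₁ ≡ Dₖ [] σ₂
    D≡ = +-cancelʳ-≡ _ _ _ (trans (Dₖ-canonical ord₁ in₁) (sym (Dₖ-canonical ord₂ in₂)))
    S≡ : Sₖ [] σ₁ ≡ Sₖ [] σ₂
    S≡ = +-cancelˡ-≡ (Nₖ [] σ₁) _ _ (+-cancelʳ-≡ (Dₖ [] σ₁) _ _ (begin
      Nₖ [] σ₁ + Sₖ [] σ₁ + Dₖ [] σ₁ ≡⟨ Nₖ+Sₖ+Dₖ≡length [] σ₁ ⟩
      length σ₁                      ≡⟨ ordering-length ord₁ ⟩
      length TE                      ≡⟨ ordering-length ord₂ ⟨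
      length σ₂                      ≡⟨ Nₖ+Sₖ+Dₖ≡length [] σ₂ ⟨
      Nₖ [] σ₂ + Sₖ [] σ₂ + Dₖ [] σ₂ ≡⟨ cong₂ (λ N D → N + Sₖ [] σ₂ + D) N≡ D≡ ⟨
      Nₖ [] σ₁ + Sₖ [] σ₂ + Dₖ [] σ₁ ∎))

EG⇒InPartsEdge : ∀ {n r r≥2 C} {G : Graph n} {c : EdgeColouring G C} (P : PrunedEnergyGraph r r≥2 G c) →
                 ∀ {u v} → EG P u v → InPartsEdge (part P) (u , v)
EG⇒InPartsEdge P uv = EG-vert P uv , EG-vert P (EG-sym P uv)

ordering-InParts : ∀ {n r} (part : Fin n → Fin r) {TE σ} → IsOrdering TE σ →
                   All (InPartsEdge part) TE → All (InPartsEdge part) σ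
ordering-InParts part (_ , σ↭σ′ , σ′≈TE) TE-in =
  All-resp-↭ (↭.↭-sym σ↭σ′) (pointwise⁻ σ′≈TE TE-in)
  where
  reorient : ∀ {e f} → SameEdge e f → InPartsEdge part f → InPartsEdge part e
  reorient (inj₁ (refl , refl)) f-in           = f-in
  reorient (inj₂ (refl , refl)) (u-in , v-in) = v-in , u-in
  pointwise⁻ : ∀ {σ′ TE} → Pointwise SameEdge σ′ TE →
               All (InPartsEdge part) TE → All (InPartsEdge part) σ′
  pointwise⁻ []            []             = []
  pointwise⁻ (e≈f ∷ same) (f-in ∷ TE-in) = reorient e≈f f-in ∷ pointwise⁻ same TE-in

mainTheorem5 : (n r : ℕ) (r≥2 : 2 ≤ r) (C : Set) (G : Graph n) (c : EdgeColouring G C)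
    (P : PrunedEnergyGraph r r≥2 G c) (H : Subgraph G) (TE : List (OEdge n r)) →
    IsSubgraphEdges P TE →
    (σ₁ σ₂ : List (OEdge n r)) →
    IsOrdering TE σ₁ → Compatible H σ₁ →
    IsOrdering TE σ₂ → Compatible H σ₂ →
    ((k : Fin r) →
        (Nk (part P) H σ₁ k ≡ Nk (part P) H σ₂ k)
      × (Sk (part P) H σ₁ k ≡ Sk (part P) H σ₂ k)
      × (Dk (part P) H σ₁ k ≡ Dk (part P) H σ₂ k))
    × (Ntot (part P) H σ₁ ≡ Ntot (part P) H σ₂)
    × (Stot (part P) H σ₁ ≡ Stot (part P) H σ₂)
    × (Dtot (part P) H σ₁ ≡ Dtot (part P) H σ₂)
mainTheorem5 n r r≥2 C G c P H TE (TE⊆G⃗ , _) σ₁ σ₂ ord₁ compat₁ ord₂ compat₂ =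
  NSDₖ ,
  sumK-cong (proj₁ ∘ NSDₖ) , sumK-cong (proj₁ ∘ proj₂ ∘ NSDₖ) , sumK-cong (proj₂ ∘ proj₂ ∘ NSDₖ)
  where
  in-parts : ∀ {σ} → IsOrdering TE σ → All (InPartsEdge (part P)) σ
  in-parts ord = ordering-InParts (part P) ord (All.map (EG⇒InPartsEdge P) TE⊆G⃗)
  NSDₖ : (k : Fin r) → (Nk (part P) H σ₁ k ≡ Nk (part P) H σ₂ k)
                     × (Sk (part P) H σ₁ k ≡ Sk (part P) H σ₂ k)
                     × (Dk (part P) H σ₁ k ≡ Dk (part P) H σ₂ k)
  NSDₖ k = Coordinate.NSDₖ-invariant (part P) H k
             ord₁ (in-parts ord₁) compat₁ ord₂ (in-parts ord₂) compat₂
  sumK-cong : ∀ {f g : Fin r → ℕ} → f ≗ g → sumK r f ≡ sumK r g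
  sumK-cong f≗g = cong sum (map-cong f≗g (allFin r))
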